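{- For $n\ge 1$ let $a_n = |S_n^2(132,231)|$. Then $a_1=1$ and $a_{n+1} = 2a_n + 2^{n}$ for all $n \ge 1$.
   Context: A $3$-permutation of size $n$ is an ordered pair $(\sigma,\sigma')$ of permutations of $[n]=\{1,\dots,n\}$. A (classical) permutation $\tau\in S_n$ contains a pattern $\pi\in S_k$ if there are indices $c_1<\dots<c_k$ such that $\tau(c_1)\cdots\tau(c_k)$ is order-isomorphic to $\pi$, and avoids $\pi$ otherwise. A $3$-permutation $(\sigma,\sigma')$ avoids a pattern $\pi\in S_k$ if each of the three permutations $\sigma$, $\sigma'$, and $\sigma'\circ\sigma^{ -1}$ (where $(\sigma'\circ\sigma^{ -1})(i)=\sigma'(\sigma^{ -1}(i))$) avoids $\pi$. $S_n^2(\pi_1,\dots,\pi_m)$ denotes the set of $3$-permutations of size $n$ avoiding each of $\pi_1,\dots,\pi_m$. Patterns are written in one-line notation. -}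

module Defs where

open import Data.Nat using (ℕ)
open import Data.Fin using (Fin; _<_)
open import Data.Fin.Patterns using (0F; 1F; 2F)
open import Data.Vec using (Vec; lookup; []; _∷_)
open import Data.List using (List; length)
open import Data.List.Membership.Propositional using (_∈_)
open import Data.List.Relation.Unary.Unique.Propositional using (Unique)
open import Data.Product using (Σ; _×_; ∃; _,_)
open import Function.Bundles using (_⇔_)
open import Function.Definitions using (Injective)
open import Relation.Binary.PropositionalEquality using (_≡_)
open import Relation.Nullary using (¬_)

-- A permutation of [n] in one-line notation: the vector (σ(1),…,σ(n)),
-- with values in Fin n (value j represents j+1).
Word : ℕ → Set
Word n = Vec (Fin n) n

IsPerm : ∀ {n} → Word n → Set
IsPerm {n} v = Injective _≡_ _≡_ (lookup v)

Contains : ∀ {n k} → Word n → Word k → Set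
Contains {n} {k} τ π =
  Σ (Fin k → Fin n) λ c →
    (∀ a b → a < b → c a < c b) ×
    (∀ a b → (lookup τ (c a) < lookup τ (c b)) ⇔ (lookup π a < lookup π b))

Avoids : ∀ {n k} → Word n → Word k → Set
Avoids τ π = ¬ Contains τ π

-- τ is the composite σ' ∘ σ⁻¹ (for σ a permutation): τ(σ(i)) = σ'(i) for all i.
IsCompInv : ∀ {n} → Word n → Word n → Word n → Set
IsCompInv σ σ' τ = ∀ i → lookup τ (lookup σ i) ≡ lookup σ' i

p132 : Word 3
p132 = 0F ∷ 2F ∷ 1F ∷ []

p231 : Word 3
p231 = 1F ∷ 2F ∷ 0F ∷ []

AvoidsBoth : ∀ {n} → Word n → Set
AvoidsBoth τ = Avoids τ p132 × Avoids τ p231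

InS2 : (n : ℕ) → Word n × Word n → Set
InS2 n (σ , σ') =
  IsPerm σ × IsPerm σ' × AvoidsBoth σ × AvoidsBoth σ' ×
  (∀ τ → IsCompInv σ σ' τ → AvoidsBoth τ)

HasCard : {A : Set} → (A → Set) → ℕ → Set
HasCard {A} P k =
  Σ (List A) λ L → Unique L × length L ≡ k × (∀ x → (x ∈ L) ⇔ P x)

-- A permutation avoids both 132 and 231 exactly when it has no peak i < j < k with
-- w i < w j > w k.  The maximum of a peak-free permutation sits at its first or last
-- position, and deleting it leaves a peak-free permutation, so there are 2ⁿ⁻¹ of size n.
-- Now let σ, σ′ and τ = σ′ ∘ σ⁻¹ be peak-free and look at where σ and σ′ put their maxima.
-- If both put it first, or both last, then τ ends with its maximum and deleting the three
-- maxima gives a smaller such triple.  If σ puts it last and σ′ first, then τ takes its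
-- maximum at position σ(1), which forces σ(1) = 1, hence σ = id and σ′ = τ is any peak-free
-- permutation starting with its maximum.  Symmetrically, if σ puts it first and σ′ last, then
-- σ(last) = 1, so σ is the reversal and τ is any peak-free permutation starting with its
-- maximum.  Hence a(n+1) = 2 a(n) + 2 · 2ⁿ⁻¹.

module Submission where

open import Data.Nat using (ℕ; suc; _+_; _*_; _^_; _≤_)
open import Data.Product using (Σ; _×_)
open import Relation.Binary.PropositionalEquality using (_≡_)

open import Defs
open import Data.Nat as ℕ using (zero; z<s; s<s)
import Data.Nat.Properties as ℕ
open import Data.Fin as Fin using (Fin; zero; suc; fromℕ; inject₁; opposite; _<_)
open import Data.Fin.Patterns using (0F; 1F; 2F)
import Data.Fin.Properties as Fin
open import Data.Fin.Relation.Unary.Top using (view; ‵fromℕ; ‵inject₁)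
open import Data.Vec as Vec using (Vec; []; _∷_; lookup; tabulate; allFin)
open import Data.Vec.Properties using (lookup-map; lookup∘tabulate; lookup-allFin; tabulate∘lookup; tabulate-cong; ∷-injectiveˡ; ∷-injectiveʳ)
open import Data.List using (List; length; map; _++_; [_])
open import Data.List.Properties using (length-++; length-map)
open import Data.List.Relation.Unary.All as All using (All)
import Data.List.Relation.Unary.All.Properties as All
open import Data.List.Relation.Unary.Any using (here)
open import Data.List.Relation.Unary.AllPairs using ([]; _∷_)
open import Data.List.Relation.Unary.Unique.Propositional using (Unique)
import Data.List.Relation.Unary.Unique.Propositional.Properties as Unique
open import Data.List.Relation.Binary.Disjoint.Propositional using (Disjoint)
open import Data.List.Membership.Propositional using (_∈_)
open import Data.List.Membership.Propositional.Properties using (∈-map⁺; ∈-++⁺ˡ; ∈-++⁺ʳ)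
open import Data.Product using (_,_; proj₁; proj₂; ∃)
open import Data.Product.Properties using (,-injectiveˡ; ,-injectiveʳ)
open import Data.Sum using (_⊎_; inj₁; inj₂)
open import Data.Empty using (⊥; ⊥-elim)
open import Function using (_∘_; _⇔_; mk⇔; Equivalence)
open import Relation.Binary using (tri<; tri≈; tri>)
open import Relation.Binary.PropositionalEquality using (refl; sym; trans; cong; cong₂; subst; subst₂; _≢_; module ≡-Reasoning)
open import Relation.Nullary using (¬_; yes; no)

fromℕ≮ : ∀ {n} {i : Fin (suc n)} → fromℕ n < i → ⊥
fromℕ≮ {i = i} max<i = ℕ.<⇒≱ max<i (Fin.≤fromℕ i)

inject₁-<⁺ : ∀ {n} {i j : Fin n} → i < j → inject₁ i < inject₁ j
inject₁-<⁺ {i = i} {j} = subst₂ ℕ._<_ (sym (Fin.toℕ-inject₁ i)) (sym (Fin.toℕ-inject₁ j))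

inject₁-<⁻ : ∀ {n} {i j : Fin n} → inject₁ i < inject₁ j → i < j
inject₁-<⁻ {i = i} {j} = subst₂ ℕ._<_ (Fin.toℕ-inject₁ i) (Fin.toℕ-inject₁ j)

opposite-< : ∀ {n} {i j : Fin n} → i < j → opposite j < opposite i
opposite-< {i = i} {j} i<j = subst₂ ℕ._<_ (sym (Fin.opposite-prop j)) (sym (Fin.opposite-prop i))
  (ℕ.∸-monoʳ-< (s<s i<j) (Fin.toℕ<n j))

opposite-injective : ∀ {n} {i j : Fin n} → opposite i ≡ opposite j → i ≡ j
opposite-injective {i = i} {j} eq =
  trans (sym (Fin.opposite-involutive i)) (trans (cong opposite eq) (Fin.opposite-involutive j))

opposite-fromℕ : ∀ n → opposite (fromℕ n) ≡ zero
opposite-fromℕ n = Fin.opposite-involutive zero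

opposite-inject₁ : ∀ {n} (i : Fin n) → opposite (inject₁ i) ≡ suc (opposite i)
opposite-inject₁ i = begin
  opposite (inject₁ i)                       ≡⟨ cong (opposite ∘ inject₁) (Fin.opposite-involutive i) ⟨
  opposite (opposite (suc (opposite i)))     ≡⟨ Fin.opposite-involutive (suc (opposite i)) ⟩
  suc (opposite i)                           ∎
  where open ≡-Reasoning

lookup-ext : ∀ {A : Set} {n} {xs ys : Vec A n} → (∀ i → lookup xs i ≡ lookup ys i) → xs ≡ ys
lookup-ext {xs = xs} {ys} eq = begin
  xs                    ≡⟨ tabulate∘lookup xs ⟨
  tabulate (lookup xs)  ≡⟨ tabulate-cong eq ⟩
  tabulate (lookup ys)  ≡⟨ tabulate∘lookup ys ⟩
  ys                    ∎
  where open ≡-Reasoning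

map-inject₁-injective : ∀ {m n} {xs ys : Vec (Fin n) m} →
  Vec.map inject₁ xs ≡ Vec.map inject₁ ys → xs ≡ ys
map-inject₁-injective {xs = []} {[]} _ = refl
map-inject₁-injective {xs = x ∷ xs} {y ∷ ys} eq =
  cong₂ _∷_ (Fin.inject₁-injective (∷-injectiveˡ eq)) (map-inject₁-injective (∷-injectiveʳ eq))

-- Data.Vec.reverse is defined by a fold; describing the result through lookups is what we need.
reverse : ∀ {A : Set} {n} → Vec A n → Vec A n
reverse xs = tabulate (lookup xs ∘ opposite)

lookup-reverse : ∀ {A : Set} {n} (xs : Vec A n) i → lookup (reverse xs) i ≡ lookup xs (opposite i)
lookup-reverse xs = lookup∘tabulate (lookup xs ∘ opposite)

reverse-involutive : ∀ {A : Set} {n} (xs : Vec A n) → reverse (reverse xs) ≡ xs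
reverse-involutive xs = lookup-ext λ i → begin
  lookup (reverse (reverse xs)) i  ≡⟨ lookup-reverse (reverse xs) i ⟩
  lookup (reverse xs) (opposite i) ≡⟨ lookup-reverse xs (opposite i) ⟩
  lookup xs (opposite (opposite i)) ≡⟨ cong (lookup xs) (Fin.opposite-involutive i) ⟩
  lookup xs i                      ∎
  where open ≡-Reasoning

reverse-injective : ∀ {A : Set} {n} {xs ys : Vec A n} → reverse xs ≡ reverse ys → xs ≡ ys
reverse-injective {xs = xs} {ys} eq =
  trans (sym (reverse-involutive xs)) (trans (cong reverse eq) (reverse-involutive ys))

lookup-reverse-allFin : ∀ {n} (i : Fin n) → lookup (reverse (allFin n)) i ≡ opposite i
lookup-reverse-allFin i = trans (lookup-reverse (allFin _) i) (lookup-allFin (opposite i))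

disjoint-by : ∀ {A : Set} (P : A → Set) {xs ys : List A} → All P xs → All (¬_ ∘ P) ys → Disjoint xs ys
disjoint-by P all-P all-¬P (x∈xs , x∈ys) = All.lookup all-¬P x∈ys (All.lookup all-P x∈xs)

all-map : ∀ {A B : Set} {P : B → Set} (f : A → B) → (∀ x → P (f x)) → ∀ xs → All P (map f xs)
all-map f Pf xs = All.map⁺ (All.universal Pf xs)

length-map-++-map : ∀ {A B C : Set} (f : A → C) (g : B → C) xs ys →
  length (map f xs ++ map g ys) ≡ length xs + length ys
length-map-++-map f g xs ys = trans (length-++ (map f xs)) (cong₂ _+_ (length-map f xs) (length-map g ys))

-- Peaks and the patterns 132 and 231

PeakFree : ∀ {m n} → Vec (Fin n) m → Set
PeakFree w = ∀ {i j k} → i < j → j < k → lookup w i < lookup w j → lookup w k < lookup w j → ⊥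

record PeakFreePerm {n} (w : Word n) : Set where
  constructor _,_
  field
    isPerm   : IsPerm w
    peakFree : PeakFree w

peakFree⇒avoidsBoth : ∀ {n} (τ : Word n) → PeakFree τ → AvoidsBoth τ
peakFree⇒avoidsBoth τ peakFree = avoid132 , avoid231
  where
  avoid132 : Avoids τ p132
  avoid132 (c , increasing , orderIso) =
    peakFree (increasing 0F 1F z<s) (increasing 1F 2F (s<s z<s))
      (Equivalence.from (orderIso 0F 1F) z<s) (Equivalence.from (orderIso 2F 1F) (s<s z<s))
  avoid231 : Avoids τ p231
  avoid231 (c , increasing , orderIso) =
    peakFree (increasing 0F 1F z<s) (increasing 1F 2F (s<s z<s))
      (Equivalence.from (orderIso 0F 1F) (s<s z<s)) (Equivalence.from (orderIso 2F 1F) z<s)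

leftInverse⇒isPerm : ∀ {n} (π π′ : Word n) → (∀ a → lookup π′ (lookup π a) ≡ a) → IsPerm π
leftInverse⇒isPerm π π′ inverse {a} {b} πa≡πb =
  trans (sym (inverse a)) (trans (cong (lookup π′) πa≡πb) (inverse b))

occurrence : ∀ {n} (τ : Word n) (π : Word 3) → IsPerm π → (c : Fin 3 → Fin n) →
  (∀ a b → a < b → c a < c b) →
  (∀ a b → lookup π a < lookup π b → lookup τ (c a) < lookup τ (c b)) → Contains τ π
occurrence τ π π-perm c increasing order = c , increasing , λ a b → mk⇔ (reflect a b) (order a b)
  where
  reflect : ∀ a b → lookup τ (c a) < lookup τ (c b) → lookup π a < lookup π b
  reflect a b τa<τb with Fin.<-cmp (lookup π a) (lookup π b)
  ... | tri< πa<πb _ _ = πa<πb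
  ... | tri≈ _ πa≡πb _ rewrite π-perm πa≡πb = ⊥-elim (Fin.<-irrefl refl τa<τb)
  ... | tri> _ _ πb<πa = ⊥-elim (Fin.<-asym τa<τb (order b a πb<πa))

triple-increasing : ∀ {n} {i j k : Fin n} → i < j → j < k →
  ∀ a b → a < b → lookup (i ∷ j ∷ k ∷ []) a < lookup (i ∷ j ∷ k ∷ []) b
triple-increasing i<j j<k 0F 1F _ = i<j
triple-increasing i<j j<k 0F 2F _ = Fin.<-trans i<j j<k
triple-increasing i<j j<k 1F 2F _ = j<k
triple-increasing i<j j<k 0F 0F ()
triple-increasing i<j j<k 1F 0F ()
triple-increasing i<j j<k 1F 1F (s<s ())
triple-increasing i<j j<k 2F 0F ()
triple-increasing i<j j<k 2F 1F (s<s ())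
triple-increasing i<j j<k 2F 2F (s<s (s<s ()))

avoidsBoth⇒peakFree : ∀ {n} (τ : Word n) → IsPerm τ → AvoidsBoth τ → PeakFree τ
avoidsBoth⇒peakFree τ τ-perm (avoid132 , avoid231) {i} {j} {k} i<j j<k τi<τj τk<τj
  with Fin.<-cmp (lookup τ i) (lookup τ k)
... | tri< τi<τk _ _ = avoid132 (occurrence τ p132 p132-perm c (triple-increasing i<j j<k) order132)
  where
  c : Fin 3 → Fin _
  c = lookup (i ∷ j ∷ k ∷ [])
  p132-perm : IsPerm p132
  p132-perm = leftInverse⇒isPerm p132 p132 λ { 0F → refl ; 1F → refl ; 2F → refl }
  order132 : ∀ a b → lookup p132 a < lookup p132 b → lookup τ (c a) < lookup τ (c b)
  order132 0F 1F _ = τi<τj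
  order132 0F 2F _ = τi<τk
  order132 2F 1F _ = τk<τj
  order132 0F 0F ()
  order132 1F 0F ()
  order132 1F 1F (s<s (s<s ()))
  order132 1F 2F (s<s ())
  order132 2F 0F ()
  order132 2F 2F (s<s ())
... | tri≈ _ τi≡τk _ = Fin.<⇒≢ (Fin.<-trans i<j j<k) (τ-perm τi≡τk)
... | tri> _ _ τk<τi = avoid231 (occurrence τ p231 p231-perm c (triple-increasing i<j j<k) order231)
  where
  c : Fin 3 → Fin _
  c = lookup (i ∷ j ∷ k ∷ [])
  p231-perm : IsPerm p231
  p231-perm = leftInverse⇒isPerm p231 (2F ∷ 0F ∷ 1F ∷ []) λ { 0F → refl ; 1F → refl ; 2F → refl }
  order231 : ∀ a b → lookup p231 a < lookup p231 b → lookup τ (c a) < lookup τ (c b)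
  order231 0F 1F _ = τi<τj
  order231 2F 0F _ = τk<τi
  order231 2F 1F _ = τk<τj
  order231 0F 0F (s<s ())
  order231 0F 2F ()
  order231 1F 0F (s<s ())
  order231 1F 1F (s<s (s<s ()))
  order231 1F 2F ()
  order231 2F 2F ()

isPerm⇒surjective : ∀ {n} (w : Word n) → IsPerm w → ∀ j → ∃ λ i → lookup w i ≡ j
isPerm⇒surjective {zero} _ _ ()
isPerm⇒surjective {suc n} w w-perm j with Fin.any? (λ i → lookup w i Fin.≟ j)
... | yes hit = hit
... | no miss = ⊥-elim (collision (Fin.pigeonhole (ℕ.n<1+n n) (Fin.punchOut ∘ missed)))
  where
  missed : ∀ i → j ≢ lookup w i
  missed i j≡wi = miss (i , sym j≡wi)
  collision : (∃ λ a → ∃ λ b → a < b × Fin.punchOut (missed a) ≡ Fin.punchOut (missed b)) → ⊥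
  collision (a , b , a<b , same) =
    Fin.<⇒≢ a<b (w-perm (Fin.punchOut-injective (missed a) (missed b) same))

compInv-exists : ∀ {n} {s : Word n} → IsPerm s → (t : Word n) → ∃ λ u → IsCompInv s t u
compInv-exists {s = s} s-perm t = tabulate (lookup t ∘ preimage) , λ i →
  trans (lookup∘tabulate (lookup t ∘ preimage) (lookup s i))
        (cong (lookup t) (s-perm (proj₂ (isPerm⇒surjective s s-perm (lookup s i)))))
  where
  preimage : Fin _ → Fin _
  preimage j = proj₁ (isPerm⇒surjective s s-perm j)

compInv-unique : ∀ {n} {s t u u′ : Word n} → IsPerm s → IsCompInv s t u → IsCompInv s t u′ → u ≡ u′
compInv-unique {s = s} {t} {u} {u′} s-perm comp comp′ = lookup-ext agree
  where
  agree : ∀ j → lookup u j ≡ lookup u′ j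
  agree j with isPerm⇒surjective s s-perm j
  ... | i , refl = trans (comp i) (sym (comp′ i))

compInv-isPerm : ∀ {n} {s t u : Word n} → IsPerm s → IsPerm t → IsCompInv s t u → IsPerm u
compInv-isPerm {s = s} {t} {u} s-perm t-perm comp {x} {y} ux≡uy
  with isPerm⇒surjective s s-perm x | isPerm⇒surjective s s-perm y
... | i , refl | j , refl = cong (lookup s) (t-perm (trans (sym (comp i)) (trans ux≡uy (comp j))))

compInv-max : ∀ {n} {s t u : Word (suc n)} → IsCompInv s t u →
  ∀ i → lookup s i ≡ fromℕ n → lookup t i ≡ fromℕ n → lookup u (fromℕ n) ≡ fromℕ n
compInv-max {u = u} comp i si≡max ti≡max = trans (cong (lookup u) (sym si≡max)) (trans (comp i) ti≡max)

-- Adding a new maximum at either end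

front : ∀ {n} → Word n → Word (suc n)
front {n} w = fromℕ n ∷ Vec.map inject₁ w

back : ∀ {n} → Word n → Word (suc n)
back = reverse ∘ front ∘ reverse

lookup-front-suc : ∀ {n} (w : Word n) i → lookup (front w) (suc i) ≡ inject₁ (lookup w i)
lookup-front-suc w i = lookup-map i inject₁ w

lookup-back-fromℕ : ∀ {n} (w : Word n) → lookup (back w) (fromℕ n) ≡ fromℕ n
lookup-back-fromℕ {n} w =
  trans (lookup-reverse (front (reverse w)) (fromℕ n)) (cong (lookup (front (reverse w))) (opposite-fromℕ n))

lookup-back-inject₁ : ∀ {n} (w : Word n) i → lookup (back w) (inject₁ i) ≡ inject₁ (lookup w i)
lookup-back-inject₁ w i = begin
  lookup (back w) (inject₁ i)                      ≡⟨ lookup-reverse (front (reverse w)) (inject₁ i) ⟩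
  lookup (front (reverse w)) (opposite (inject₁ i)) ≡⟨ cong (lookup (front (reverse w))) (opposite-inject₁ i) ⟩
  lookup (front (reverse w)) (suc (opposite i))    ≡⟨ lookup-front-suc (reverse w) (opposite i) ⟩
  inject₁ (lookup (reverse w) (opposite i))        ≡⟨ cong inject₁ (lookup-reverse w (opposite i)) ⟩
  inject₁ (lookup w (opposite (opposite i)))       ≡⟨ cong (inject₁ ∘ lookup w) (Fin.opposite-involutive i) ⟩
  inject₁ (lookup w i)                             ∎
  where open ≡-Reasoning

front-injective : ∀ {n} {v w : Word n} → front v ≡ front w → v ≡ w
front-injective = map-inject₁-injective ∘ ∷-injectiveʳ

back-injective : ∀ {n} {v w : Word n} → back v ≡ back w → v ≡ w
back-injective = reverse-injective ∘ front-injective ∘ reverse-injective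

HeadIsMax : ∀ {n} → Word (suc n) → Set
HeadIsMax {n} w = lookup w zero ≡ fromℕ n

back-head : ∀ {n} (w : Word (suc n)) → ¬ HeadIsMax (back w)
back-head w head≡max = Fin.fromℕ≢inject₁ (trans (sym head≡max) (lookup-back-inject₁ w zero))

reverse-front-head : ∀ {n} (w : Word (suc n)) → ¬ HeadIsMax (reverse (front w))
reverse-front-head {n} w head≡max = Fin.fromℕ≢inject₁ (trans (sym head≡max) (lookup-front-suc w (fromℕ n)))

front⁺ : ∀ {n} {w : Word n} → PeakFreePerm w → PeakFreePerm (front w)
front⁺ {w = w} (w-perm , w-peakFree) = perm , peakFree
  where
  perm : IsPerm (front w)
  perm {zero} {zero} _ = refl
  perm {zero} {suc j} eq = ⊥-elim (Fin.fromℕ≢inject₁ (trans eq (lookup-front-suc w j)))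
  perm {suc i} {zero} eq = ⊥-elim (Fin.fromℕ≢inject₁ (trans (sym eq) (lookup-front-suc w i)))
  perm {suc i} {suc j} eq = cong suc (w-perm (Fin.inject₁-injective
    (trans (sym (lookup-front-suc w i)) (trans eq (lookup-front-suc w j)))))
  lower : ∀ {i j} → lookup (front w) (suc i) < lookup (front w) (suc j) → lookup w i < lookup w j
  lower {i} {j} = inject₁-<⁻ ∘ subst₂ _<_ (lookup-front-suc w i) (lookup-front-suc w j)
  peakFree : PeakFree (front w)
  peakFree {zero} _ _ max<wj _ = fromℕ≮ max<wj
  peakFree {suc i} {zero} () _ _ _
  peakFree {suc i} {suc j} {zero} _ () _ _
  peakFree {suc i} {suc j} {suc k} (s<s i<j) (s<s j<k) wi<wj wk<wj =
    w-peakFree i<j j<k (lower wi<wj) (lower wk<wj)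

front⁻ : ∀ {n} {w : Word n} → PeakFreePerm (front w) → PeakFreePerm w
front⁻ {w = w} (perm , peakFree) = w-perm , w-peakFree
  where
  w-perm : IsPerm w
  w-perm {i} {j} eq = Fin.suc-injective (perm
    (trans (lookup-front-suc w i) (trans (cong inject₁ eq) (sym (lookup-front-suc w j)))))
  raise : ∀ {i j} → lookup w i < lookup w j → lookup (front w) (suc i) < lookup (front w) (suc j)
  raise {i} {j} = subst₂ _<_ (sym (lookup-front-suc w i)) (sym (lookup-front-suc w j)) ∘ inject₁-<⁺
  w-peakFree : PeakFree w
  w-peakFree i<j j<k wi<wj wk<wj = peakFree (s<s i<j) (s<s j<k) (raise wi<wj) (raise wk<wj)

reverse⁺ : ∀ {n} {w : Word n} → PeakFreePerm w → PeakFreePerm (reverse w)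
reverse⁺ {w = w} (w-perm , w-peakFree) = perm , peakFree
  where
  perm : IsPerm (reverse w)
  perm {i} {j} eq = opposite-injective (w-perm
    (trans (sym (lookup-reverse w i)) (trans eq (lookup-reverse w j))))
  peakFree : PeakFree (reverse w)
  peakFree {i} {j} {k} i<j j<k wi<wj wk<wj = w-peakFree (opposite-< j<k) (opposite-< i<j)
    (subst₂ _<_ (lookup-reverse w k) (lookup-reverse w j) wk<wj)
    (subst₂ _<_ (lookup-reverse w i) (lookup-reverse w j) wi<wj)

reverse⁻ : ∀ {n} {w : Word n} → PeakFreePerm (reverse w) → PeakFreePerm w
reverse⁻ {w = w} = subst PeakFreePerm (reverse-involutive w) ∘ reverse⁺

back⁺ : ∀ {n} {w : Word n} → PeakFreePerm w → PeakFreePerm (back w)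
back⁺ = reverse⁺ ∘ front⁺ ∘ reverse⁺

back⁻ : ∀ {n} {w : Word n} → PeakFreePerm (back w) → PeakFreePerm w
back⁻ = reverse⁻ ∘ front⁻ ∘ reverse⁻

singleton⁺ : PeakFreePerm (0F ∷ [])
singleton⁺ = perm , peakFree
  where
  perm : IsPerm (0F ∷ [])
  perm {zero} {zero} _ = refl
  peakFree : PeakFree (0F ∷ [])
  peakFree {zero} {zero} ()

allFin⁺ : ∀ n → PeakFreePerm (allFin n)
allFin⁺ n = perm , peakFree
  where
  perm : IsPerm (allFin n)
  perm {i} {j} eq = trans (sym (lookup-allFin i)) (trans eq (lookup-allFin j))
  peakFree : PeakFree (allFin n)
  peakFree {j = j} {k} _ j<k _ k<j =
    Fin.<-asym j<k (subst₂ _<_ (lookup-allFin k) (lookup-allFin j) k<j)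

compInv-inject₁ : ∀ {n} (u′ : Word (suc n)) (u : Word n) →
  (∀ x → lookup u′ (inject₁ x) ≡ inject₁ (lookup u x)) →
  ∀ {x′ y′ x y} → x′ ≡ inject₁ x → y′ ≡ inject₁ y →
  (lookup u′ x′ ≡ y′) ⇔ (lookup u x ≡ y)
compInv-inject₁ u′ u u-lift {x = x} refl refl =
  mk⇔ (λ eq → Fin.inject₁-injective (trans (sym (u-lift x)) eq)) (λ eq → trans (u-lift x) (cong inject₁ eq))

compInv-front : ∀ {n} {s t u : Word n} → IsCompInv (front s) (front t) (back u) ⇔ IsCompInv s t u
compInv-front {s = s} {t} {u} = mk⇔ (λ comp i → Equivalence.to (at i) (comp (suc i))) extend
  where
  at : ∀ i → (lookup (back u) (lookup (front s) (suc i)) ≡ lookup (front t) (suc i)) ⇔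
             (lookup u (lookup s i) ≡ lookup t i)
  at i = compInv-inject₁ (back u) u (lookup-back-inject₁ u) (lookup-front-suc s i) (lookup-front-suc t i)
  extend : IsCompInv s t u → IsCompInv (front s) (front t) (back u)
  extend comp zero = lookup-back-fromℕ u
  extend comp (suc i) = Equivalence.from (at i) (comp i)

compInv-back : ∀ {n} {s t u : Word n} → IsCompInv (back s) (back t) (back u) ⇔ IsCompInv s t u
compInv-back {s = s} {t} {u} = mk⇔ (λ comp i → Equivalence.to (at i) (comp (inject₁ i))) extend
  where
  at : ∀ i → (lookup (back u) (lookup (back s) (inject₁ i)) ≡ lookup (back t) (inject₁ i)) ⇔
             (lookup u (lookup s i) ≡ lookup t i)
  at i = compInv-inject₁ (back u) u (lookup-back-inject₁ u) (lookup-back-inject₁ s i) (lookup-back-inject₁ t i)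
  extend : IsCompInv s t u → IsCompInv (back s) (back t) (back u)
  extend comp i with view i
  ... | ‵fromℕ = trans (cong (lookup (back u)) (lookup-back-fromℕ s))
                       (trans (lookup-back-fromℕ u) (sym (lookup-back-fromℕ t)))
  ... | ‵inject₁ j = Equivalence.from (at j) (comp j)

-- The maximum of a peak-free permutation sits at an end

position-of-max : ∀ {n} {w : Word (suc n)} → PeakFreePerm w →
  ∀ p → lookup w p ≡ fromℕ n → p ≡ zero ⊎ p ≡ fromℕ n
position-of-max _ zero _ = inj₁ refl
position-of-max {n} {w} (w-perm , w-peakFree) (suc q) wp≡max with suc q Fin.≟ fromℕ n
... | yes p≡last = inj₂ p≡last
... | no p≢last = ⊥-elim (w-peakFree z<s (Fin.≤∧≢⇒< (Fin.≤fromℕ (suc q)) p≢last)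
                                     (belowMax λ ()) (belowMax (p≢last ∘ sym)))
  where
  belowMax : ∀ {i} → i ≢ suc q → lookup w i < lookup w (suc q)
  belowMax {i} i≢p = subst (lookup w i <_) (sym wp≡max)
    (Fin.≤∧≢⇒< (Fin.≤fromℕ (lookup w i)) λ wi≡max → i≢p (w-perm (trans wi≡max (sym wp≡max))))

≢fromℕ⇒map-inject₁ : ∀ {m n} (xs : Vec (Fin (suc n)) m) →
  (∀ i → lookup xs i ≢ fromℕ n) → ∃ λ v → xs ≡ Vec.map inject₁ v
≢fromℕ⇒map-inject₁ [] _ = [] , refl
≢fromℕ⇒map-inject₁ (x ∷ xs) below with view x | ≢fromℕ⇒map-inject₁ xs (below ∘ suc)
... | ‵fromℕ     | _        = ⊥-elim (below zero refl)
... | ‵inject₁ y | v , refl = y ∷ v , refl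

front-view : ∀ {n} {w : Word (suc n)} → PeakFreePerm w →
  lookup w zero ≡ fromℕ n → ∃ λ v → w ≡ front v
front-view {w = x ∷ xs} (w-perm , _) refl
  with ≢fromℕ⇒map-inject₁ xs (λ i xi≡max → Fin.0≢1+n (sym (w-perm xi≡max)))
... | v , refl = v , refl

back-view : ∀ {n} {w : Word (suc n)} → PeakFreePerm w →
  lookup w (fromℕ n) ≡ fromℕ n → ∃ λ v → w ≡ back v
back-view {w = w} w-pfp last≡max with front-view (reverse⁺ w-pfp) (trans (lookup-reverse w zero) last≡max)
... | v , rw≡fv = reverse v , (begin
  w                          ≡⟨ reverse-involutive w ⟨
  reverse (reverse w)        ≡⟨ cong reverse rw≡fv ⟩
  reverse (front v)          ≡⟨ cong (reverse ∘ front) (reverse-involutive v) ⟨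
  back (reverse v)           ∎)
  where open ≡-Reasoning

data MaxAtEnd {n} : Word (suc n) → Set where
  maxFirst : ∀ v → MaxAtEnd (front v)
  maxLast  : ∀ v → MaxAtEnd (back v)

maxAtEnd : ∀ {n} {w : Word (suc n)} → PeakFreePerm w → MaxAtEnd w
maxAtEnd {w = w} w-pfp with isPerm⇒surjective w (PeakFreePerm.isPerm w-pfp) (fromℕ _)
... | p , wp≡max with position-of-max w-pfp p wp≡max
... | inj₁ refl with front-view w-pfp wp≡max
...   | v , refl = maxFirst v
maxAtEnd w-pfp | p , wp≡max | inj₂ refl with back-view w-pfp wp≡max
...   | v , refl = maxLast v

back-allFin : ∀ n → back (allFin n) ≡ allFin (suc n)
back-allFin n = lookup-ext λ i → trans (fixed i) (sym (lookup-allFin i))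
  where
  fixed : ∀ i → lookup (back (allFin n)) i ≡ i
  fixed i with view i
  ... | ‵fromℕ     = lookup-back-fromℕ (allFin n)
  ... | ‵inject₁ j = trans (lookup-back-inject₁ (allFin n) j) (cong inject₁ (lookup-allFin j))

fixesZero⇒allFin : ∀ {n} {w : Word (suc n)} → PeakFreePerm w → lookup w zero ≡ zero → w ≡ allFin (suc n)
fixesZero⇒allFin {zero} {_ ∷ []} _ refl = refl
fixesZero⇒allFin {suc n} w-pfp w0≡0 with maxAtEnd w-pfp
... | maxFirst v = ⊥-elim (Fin.0≢1+n (sym w0≡0))
... | maxLast v = trans (cong back (fixesZero⇒allFin (back⁻ {w = v} w-pfp) v0≡0)) (back-allFin (suc n))
  where
  v0≡0 : lookup v zero ≡ zero
  v0≡0 = Fin.inject₁-injective (trans (sym (lookup-back-inject₁ v zero)) w0≡0)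

lastZero⇒reverse-allFin : ∀ {n} {w : Word (suc n)} → PeakFreePerm w →
  lookup w (fromℕ n) ≡ zero → w ≡ reverse (allFin (suc n))
lastZero⇒reverse-allFin {w = w} w-pfp last≡0 =
  trans (sym (reverse-involutive w))
        (cong reverse (fixesZero⇒allFin (reverse⁺ w-pfp) (trans (lookup-reverse w zero) last≡0)))

-- Enumerating peak-free permutations

peakFreePerms : ∀ n → List (Word (suc n))
peakFreePerms zero    = [ 0F ∷ [] ]
peakFreePerms (suc n) = map front (peakFreePerms n) ++ map back (peakFreePerms n)

peakFreePerms-sound : ∀ n → All PeakFreePerm (peakFreePerms n)
peakFreePerms-sound zero    = singleton⁺ All.∷ All.[]
peakFreePerms-sound (suc n) =
  All.++⁺ (All.map⁺ (All.map front⁺ (peakFreePerms-sound n))) (All.map⁺ (All.map back⁺ (peakFreePerms-sound n)))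

∈-peakFreePerms : ∀ n {w : Word (suc n)} → PeakFreePerm w → w ∈ peakFreePerms n
∈-peakFreePerms zero {zero ∷ []} _ = here refl
∈-peakFreePerms (suc n) w-pfp with maxAtEnd w-pfp
... | maxFirst v = ∈-++⁺ˡ (∈-map⁺ front (∈-peakFreePerms n (front⁻ {w = v} w-pfp)))
... | maxLast v  = ∈-++⁺ʳ _ (∈-map⁺ back (∈-peakFreePerms n (back⁻ {w = v} w-pfp)))

peakFreePerms-unique : ∀ n → Unique (peakFreePerms n)
peakFreePerms-unique zero    = All.[] ∷ []
peakFreePerms-unique (suc n) =
  Unique.++⁺ (Unique.map⁺ front-injective (peakFreePerms-unique n))
             (Unique.map⁺ back-injective (peakFreePerms-unique n))
             (disjoint-by HeadIsMax (all-map front (λ _ → refl) _) (all-map back back-head _))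

length-peakFreePerms : ∀ n → length (peakFreePerms n) ≡ 2 ^ n
length-peakFreePerms zero    = refl
length-peakFreePerms (suc n) = begin
  length (map front P ++ map back P) ≡⟨ length-map-++-map front back P P ⟩
  length P + length P                ≡⟨ cong (λ ℓ → ℓ + ℓ) (length-peakFreePerms n) ⟩
  2 ^ n + 2 ^ n                      ≡⟨ cong (2 ^ n +_) (ℕ.+-identityʳ (2 ^ n)) ⟨
  2 ^ suc n                          ∎
  where
  open ≡-Reasoning
  P = peakFreePerms n

-- Enumerating peak-free 3-permutations

PeakFree3Perm : ∀ {n} → Word n × Word n → Set
PeakFree3Perm (s , t) = PeakFreePerm s × PeakFreePerm t × ∃ λ u → PeakFreePerm u × IsCompInv s t u

peakFree3Perm⇒InS2 : ∀ {n} {x : Word n × Word n} → PeakFree3Perm x → InS2 n x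
peakFree3Perm⇒InS2 {x = s , t} ((s-perm , s-peakFree) , (t-perm , t-peakFree) , u , (_ , u-peakFree) , comp) =
  s-perm , t-perm , peakFree⇒avoidsBoth s s-peakFree , peakFree⇒avoidsBoth t t-peakFree ,
  λ τ τ-comp → subst AvoidsBoth (compInv-unique {s = s} {t} {u} {τ} s-perm comp τ-comp)
                     (peakFree⇒avoidsBoth u u-peakFree)

InS2⇒peakFree3Perm : ∀ {n} {x : Word n × Word n} → InS2 n x → PeakFree3Perm x
InS2⇒peakFree3Perm {x = s , t} (s-perm , t-perm , s-avoids , t-avoids , τ-avoids)
  with compInv-exists {s = s} s-perm t
... | u , comp = (s-perm , avoidsBoth⇒peakFree s s-perm s-avoids) ,
                 (t-perm , avoidsBoth⇒peakFree t t-perm t-avoids) ,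
                 u , (u-perm , avoidsBoth⇒peakFree u u-perm (τ-avoids u comp)) , comp
  where
  u-perm : IsPerm u
  u-perm = compInv-isPerm {s = s} {t} {u} s-perm t-perm comp

fronts : ∀ {n} → Word n × Word n → Word (suc n) × Word (suc n)
fronts (s , t) = front s , front t

backs : ∀ {n} → Word n × Word n → Word (suc n) × Word (suc n)
backs (s , t) = back s , back t

withIdentity : ∀ {n} → Word (suc n) → Word (suc (suc n)) × Word (suc (suc n))
withIdentity w = allFin _ , front w

withReverse : ∀ {n} → Word (suc n) → Word (suc (suc n)) × Word (suc (suc n))
withReverse w = reverse (allFin _) , reverse (front w)

-- Grouped by whether σ starts with its maximum, and within each group by whether σ′ does.
extend : ∀ {n} → List (Word (suc n) × Word (suc n)) → List (Word (suc n)) →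
  List (Word (suc (suc n)) × Word (suc (suc n)))
extend L P = (map fronts L ++ map withReverse P) ++ (map withIdentity P ++ map backs L)

peakFree3Perms : ∀ n → List (Word (suc n) × Word (suc n))
peakFree3Perms zero    = [ (0F ∷ [] , 0F ∷ []) ]
peakFree3Perms (suc n) = extend (peakFree3Perms n) (peakFreePerms n)

fronts⁺ : ∀ {n} {x : Word n × Word n} → PeakFree3Perm x → PeakFree3Perm (fronts x)
fronts⁺ {x = s , t} (s-pfp , t-pfp , u , u-pfp , comp) =
  front⁺ s-pfp , front⁺ t-pfp , back u , back⁺ u-pfp , Equivalence.from (compInv-front {s = s} {t} {u}) comp

backs⁺ : ∀ {n} {x : Word n × Word n} → PeakFree3Perm x → PeakFree3Perm (backs x)
backs⁺ {x = s , t} (s-pfp , t-pfp , u , u-pfp , comp) =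
  back⁺ s-pfp , back⁺ t-pfp , back u , back⁺ u-pfp , Equivalence.from (compInv-back {s = s} {t} {u}) comp

withIdentity⁺ : ∀ {n} {w : Word (suc n)} → PeakFreePerm w → PeakFree3Perm (withIdentity w)
withIdentity⁺ {w = w} w-pfp =
  allFin⁺ _ , front⁺ w-pfp , front w , front⁺ w-pfp , λ i → cong (lookup (front w)) (lookup-allFin i)

withReverse⁺ : ∀ {n} {w : Word (suc n)} → PeakFreePerm w → PeakFree3Perm (withReverse w)
withReverse⁺ {w = w} w-pfp =
  reverse⁺ (allFin⁺ _) , reverse⁺ (front⁺ w-pfp) , front w , front⁺ w-pfp , λ i →
    trans (cong (lookup (front w)) (lookup-reverse-allFin i)) (sym (lookup-reverse (front w) i))

extend-sound : ∀ {n} {L : List (Word (suc n) × Word (suc n))} {P : List (Word (suc n))} →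
  All PeakFree3Perm L → All PeakFreePerm P → All PeakFree3Perm (extend L P)
extend-sound all-L all-P =
  All.++⁺ (All.++⁺ (All.map⁺ (All.map fronts⁺ all-L)) (All.map⁺ (All.map withReverse⁺ all-P)))
          (All.++⁺ (All.map⁺ (All.map withIdentity⁺ all-P)) (All.map⁺ (All.map backs⁺ all-L)))

peakFree3Perms-sound : ∀ n → All PeakFree3Perm (peakFree3Perms n)
peakFree3Perms-sound zero    = (singleton⁺ , singleton⁺ , _ , singleton⁺ , λ { zero → refl }) All.∷ All.[]
peakFree3Perms-sound (suc n) = extend-sound (peakFree3Perms-sound n) (peakFreePerms-sound n)

fronts⁻ : ∀ {n} {s t : Word n} → PeakFree3Perm (front s , front t) → PeakFree3Perm (s , t)
fronts⁻ {s = s} {t} (s-pfp , t-pfp , u , u-pfp , comp)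
  with back-view u-pfp (compInv-max {s = front s} {front t} {u} comp zero refl refl)
... | u′ , refl = front⁻ {w = s} s-pfp , front⁻ {w = t} t-pfp , u′ , back⁻ {w = u′} u-pfp ,
                  Equivalence.to (compInv-front {s = s} {t} {u′}) comp

backs⁻ : ∀ {n} {s t : Word n} → PeakFree3Perm (back s , back t) → PeakFree3Perm (s , t)
backs⁻ {s = s} {t} (s-pfp , t-pfp , u , u-pfp , comp)
  with back-view u-pfp
         (compInv-max {s = back s} {back t} {u} comp (fromℕ _) (lookup-back-fromℕ s) (lookup-back-fromℕ t))
... | u′ , refl = back⁻ {w = s} s-pfp , back⁻ {w = t} t-pfp , u′ , back⁻ {w = u′} u-pfp ,
                  Equivalence.to (compInv-back {s = s} {t} {u′}) comp

withIdentity⁻ : ∀ {n} {s t : Word (suc n)} → PeakFree3Perm (back s , front t) →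
  ∃ λ w → PeakFreePerm w × (back s , front t) ≡ withIdentity w
withIdentity⁻ {s = s} {t} (s-pfp , t-pfp , u , u-pfp , comp)
  with position-of-max u-pfp (lookup (back s) zero) (comp zero)
... | inj₁ s0≡0   = t , front⁻ {w = t} t-pfp , cong (_, front t) (fixesZero⇒allFin s-pfp s0≡0)
... | inj₂ s0≡max = ⊥-elim (back-head s s0≡max)

withReverse⁻ : ∀ {n} {s t : Word (suc n)} → PeakFree3Perm (front s , back t) →
  ∃ λ w → PeakFreePerm w × (front s , back t) ≡ withReverse w
withReverse⁻ {n} {s} {t} (s-pfp , t-pfp , u , u-pfp , comp) = from-position (position-of-max u-pfp p up≡max)
  where
  p : Fin (suc (suc n))
  p = lookup (front s) (fromℕ (suc n))
  up≡max : lookup u p ≡ fromℕ (suc n)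
  up≡max = trans (comp (fromℕ (suc n))) (lookup-back-fromℕ t)
  open ≡-Reasoning
  from-position : p ≡ zero ⊎ p ≡ fromℕ (suc n) →
    ∃ λ w → PeakFreePerm w × (front s , back t) ≡ withReverse w
  from-position (inj₂ p≡max) = ⊥-elim (Fin.0≢1+n (sym (PeakFreePerm.isPerm s-pfp p≡max)))
  from-position (inj₁ p≡0) with front-view u-pfp (subst (λ q → lookup u q ≡ fromℕ (suc n)) p≡0 up≡max)
  ... | w , u≡front-w = w , front⁻ {w = w} (subst PeakFreePerm u≡front-w u-pfp) ,
                        cong₂ _,_ s≡reverse (lookup-ext t≡reverse)
    where
    s≡reverse : front s ≡ reverse (allFin _)
    s≡reverse = lastZero⇒reverse-allFin s-pfp p≡0
    t≡reverse : ∀ i → lookup (back t) i ≡ lookup (reverse (front w)) i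
    t≡reverse i = begin
      lookup (back t) i                    ≡⟨ comp i ⟨
      lookup u (lookup (front s) i)        ≡⟨ cong (λ v → lookup u (lookup v i)) s≡reverse ⟩
      lookup u (lookup (reverse (allFin _)) i) ≡⟨ cong (lookup u) (lookup-reverse-allFin i) ⟩
      lookup u (opposite i)                ≡⟨ cong (λ v → lookup v (opposite i)) u≡front-w ⟩
      lookup (front w) (opposite i)        ≡⟨ lookup-reverse (front w) i ⟨
      lookup (reverse (front w)) i         ∎

fronts-∈-extend : ∀ {n} {L : List (Word (suc n) × Word (suc n))} {P x} → x ∈ L → fronts x ∈ extend L P
fronts-∈-extend x∈L = ∈-++⁺ˡ (∈-++⁺ˡ (∈-map⁺ fronts x∈L))

withReverse-∈-extend : ∀ {n} {L : List (Word (suc n) × Word (suc n))} {P w} →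
  w ∈ P → withReverse w ∈ extend L P
withReverse-∈-extend {L = L} w∈P = ∈-++⁺ˡ (∈-++⁺ʳ (map fronts L) (∈-map⁺ withReverse w∈P))

withIdentity-∈-extend : ∀ {n} {L : List (Word (suc n) × Word (suc n))} {P w} →
  w ∈ P → withIdentity w ∈ extend L P
withIdentity-∈-extend {L = L} {P} w∈P =
  ∈-++⁺ʳ (map fronts L ++ map withReverse P) (∈-++⁺ˡ (∈-map⁺ withIdentity w∈P))

backs-∈-extend : ∀ {n} {L : List (Word (suc n) × Word (suc n))} {P x} → x ∈ L → backs x ∈ extend L P
backs-∈-extend {L = L} {P} x∈L =
  ∈-++⁺ʳ (map fronts L ++ map withReverse P) (∈-++⁺ʳ (map withIdentity P) (∈-map⁺ backs x∈L))

∈-peakFree3Perms : ∀ n {x : Word (suc n) × Word (suc n)} → PeakFree3Perm x → x ∈ peakFree3Perms n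
∈-peakFree3Perms zero {zero ∷ [] , zero ∷ []} _ = here refl
∈-peakFree3Perms (suc n) {s , t} x-pfp@(s-pfp , t-pfp , _) with maxAtEnd s-pfp | maxAtEnd t-pfp
... | maxFirst s′ | maxFirst t′ =
  fronts-∈-extend {P = peakFreePerms n} (∈-peakFree3Perms n (fronts⁻ {s = s′} {t′} x-pfp))
... | maxLast s′  | maxLast t′  =
  backs-∈-extend {P = peakFreePerms n} (∈-peakFree3Perms n (backs⁻ {s = s′} {t′} x-pfp))
... | maxFirst s′ | maxLast t′ with withReverse⁻ {s = s′} {t′} x-pfp
...   | w , w-pfp , eq =
  subst (_∈ peakFree3Perms (suc n)) (sym eq)
        (withReverse-∈-extend {L = peakFree3Perms n} (∈-peakFreePerms n w-pfp))
∈-peakFree3Perms (suc n) x-pfp | maxLast s′ | maxFirst t′ with withIdentity⁻ {s = s′} {t′} x-pfp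
...   | w , w-pfp , eq =
  subst (_∈ peakFree3Perms (suc n)) (sym eq)
        (withIdentity-∈-extend {L = peakFree3Perms n} (∈-peakFreePerms n w-pfp))

fronts-injective : ∀ {n} {x y : Word n × Word n} → fronts x ≡ fronts y → x ≡ y
fronts-injective {x = _ , _} {_ , _} eq =
  cong₂ _,_ (front-injective (,-injectiveˡ eq)) (front-injective (,-injectiveʳ eq))

backs-injective : ∀ {n} {x y : Word n × Word n} → backs x ≡ backs y → x ≡ y
backs-injective {x = _ , _} {_ , _} eq =
  cong₂ _,_ (back-injective (,-injectiveˡ eq)) (back-injective (,-injectiveʳ eq))

withIdentity-injective : ∀ {n} {v w : Word (suc n)} → withIdentity v ≡ withIdentity w → v ≡ w
withIdentity-injective = front-injective ∘ ,-injectiveʳ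

withReverse-injective : ∀ {n} {v w : Word (suc n)} → withReverse v ≡ withReverse w → v ≡ w
withReverse-injective = front-injective ∘ reverse-injective ∘ ,-injectiveʳ

extend-unique : ∀ {n} {L : List (Word (suc n) × Word (suc n))} {P : List (Word (suc n))} →
  Unique L → Unique P → Unique (extend L P)
extend-unique {L = L} {P} unique-L unique-P =
  Unique.++⁺ (Unique.++⁺ (Unique.map⁺ fronts-injective unique-L)
                         (Unique.map⁺ withReverse-injective unique-P)
                         (disjoint-by (HeadIsMax ∘ proj₂) (all-map fronts (λ _ → refl) L)
                                                           (all-map withReverse reverse-front-head P)))
             (Unique.++⁺ (Unique.map⁺ withIdentity-injective unique-P)
                         (Unique.map⁺ backs-injective unique-L)
                         (disjoint-by (HeadIsMax ∘ proj₂) (all-map withIdentity (λ _ → refl) P)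
                                                           (all-map backs (back-head ∘ proj₂) L)))
             (disjoint-by (HeadIsMax ∘ proj₁)
               (All.++⁺ (all-map fronts (λ _ → refl) L) (all-map withReverse (λ _ → lookup-allFin _) P))
               (All.++⁺ (all-map withIdentity (λ _ ()) P) (all-map backs (back-head ∘ proj₁) L)))

peakFree3Perms-unique : ∀ n → Unique (peakFree3Perms n)
peakFree3Perms-unique zero    = All.[] ∷ []
peakFree3Perms-unique (suc n) = extend-unique (peakFree3Perms-unique n) (peakFreePerms-unique n)

length-extend : ∀ {n} (L : List (Word (suc n) × Word (suc n))) (P : List (Word (suc n))) →
  length (extend L P) ≡ 2 * length L + 2 * length P
length-extend L P = begin
  length ((map fronts L ++ map withReverse P) ++ (map withIdentity P ++ map backs L))
    ≡⟨ length-++ (map fronts L ++ map withReverse P) ⟩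
  length (map fronts L ++ map withReverse P) + length (map withIdentity P ++ map backs L)
    ≡⟨ cong₂ _+_ (length-map-++-map fronts withReverse L P) (length-map-++-map withIdentity backs P L) ⟩
  (length L + length P) + (length P + length L)
    ≡⟨ cong ((length L + length P) +_) (ℕ.+-comm (length P) (length L)) ⟩
  (length L + length P) + (length L + length P)
    ≡⟨ cong ((length L + length P) +_) (ℕ.+-identityʳ (length L + length P)) ⟨
  2 * (length L + length P)
    ≡⟨ ℕ.*-distribˡ-+ 2 (length L) (length P) ⟩
  2 * length L + 2 * length P ∎
  where open ≡-Reasoning

length-peakFree3Perms : ∀ n →
  length (peakFree3Perms (suc n)) ≡ 2 * length (peakFree3Perms n) + 2 ^ suc n
length-peakFree3Perms n =
  trans (length-extend (peakFree3Perms n) (peakFreePerms n))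
        (cong (λ p → 2 * length (peakFree3Perms n) + 2 * p) (length-peakFreePerms n))

theorem3p1 : Σ (ℕ → ℕ) λ a →
    (∀ n → 1 ≤ n → HasCard (InS2 n) (a n)) ×
    a 1 ≡ 1 ×
    (∀ n → 1 ≤ n → a (suc n) ≡ 2 * a n + 2 ^ n)
theorem3p1 = length ∘ peakFree3Perms ∘ ℕ.pred , cardinality , refl , recurrence
  where
  cardinality : ∀ n → 1 ≤ n → HasCard (InS2 n) (length (peakFree3Perms (ℕ.pred n)))
  cardinality (suc n) _ = peakFree3Perms n , peakFree3Perms-unique n , refl , λ x →
    mk⇔ (peakFree3Perm⇒InS2 ∘ All.lookup (peakFree3Perms-sound n)) (∈-peakFree3Perms n ∘ InS2⇒peakFree3Perm)
  recurrence : ∀ n → 1 ≤ n → length (peakFree3Perms n) ≡ 2 * length (peakFree3Perms (ℕ.pred n)) + 2 ^ n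
  recurrence (suc n) _ = length-peakFree3Perms n
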